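{- Let $\pi$ be a permutation of $[n]$, let $x_1,\dots,x_r\in[n]$ be distinct, and let $\rho$ be a permutation of $[r]$. Then for every permutation $\sigma$ of $[n]$, $$P(\mathrm{Swap}(\pi;x_1,\dots,x_r)=\sigma)=P(\mathrm{Swap}(\pi;x_{\rho(1)},\dots,x_{\rho(r)})=\sigma).$$
   Context: $\mathrm{Swap}(\pi;x_1,\dots,x_r)$ is the random permutation obtained from $\pi$ as follows: for $i=1,\dots,r$ in turn, choose $x_i'$ uniformly at random from $[n]\setminus\{x_1,\dots,x_{i-1}\}$ and exchange the values of the current permutation at positions $x_i$ and $x_i'$. -}

module Defs where

open import Data.Nat using (ℕ; suc)
open import Data.Fin using (Fin; _≟_)
open import Data.Fin.Permutation using (Permutation′; _⟨$⟩ʳ_)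
open import Data.Integer using (+_)
open import Data.Rational using (ℚ; 0ℚ; 1ℚ; _+_; _*_; _/_)
open import Data.List using (List; []; _∷_; _++_; [_]; filter; length; map; foldr; allFin)
open import Data.List.Relation.Unary.Any using (any?)
open import Data.Vec using (Vec; lookup; tabulate; _[_]≔_)
open import Data.Vec.Properties using (≡-dec)
open import Relation.Nullary using (yes; no; ¬?)

-- A permutation of [n] is represented, for the process, by its value table:
-- the vector whose entry at position i is the value π(i).
Table : ℕ → Set
Table n = Vec (Fin n) n

table : ∀ {n} → Permutation′ n → Table n
table π = tabulate (π ⟨$⟩ʳ_)

swapAt : ∀ {n} → Table n → Fin n → Fin n → Table n
swapAt v x y = (v [ x ]≔ lookup v y) [ y ]≔ lookup v x

-- uniform average of a finite list of rationals (empty list ↦ 0, never used)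
average : List ℚ → ℚ
average [] = 0ℚ
average (q ∷ qs) = foldr _+_ 0ℚ (q ∷ qs) * ((+ 1) / suc (length qs))

allowed : ∀ {n} → List (Fin n) → List (Fin n)
allowed {n} ex = filter (λ y → ¬? (any? (y ≟_) ex)) (allFin n)

-- probability that the remaining swap process, started from table v,
-- having already processed positions ex, with positions xs still to go,
-- ends in table t.
swapProbFrom : ∀ {n} → Table n → List (Fin n) → List (Fin n) → Table n → ℚ
swapProbFrom v ex [] t with ≡-dec _≟_ v t
... | yes _ = 1ℚ
... | no _ = 0ℚ
swapProbFrom v ex (x ∷ xs) t =
  average (map (λ x′ → swapProbFrom (swapAt v x x′) (ex ++ [ x ]) xs t) (allowed ex))

swapProb : ∀ {n} → Permutation′ n → List (Fin n) → Permutation′ n → ℚ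
swapProb π xs σ = swapProbFrom (table π) [] xs (table σ)

module Submission where

-- The list x ∘ ρ is a permutation of the duplicate-free list x, and permutations of lists
-- are generated by exchanges of two neighbouring entries; the law after a step depends
-- on the processed positions only through the set they form.  So everything reduces to
-- two consecutive positions a ≠ b, both outside the processed set; let W be the set of
-- admissible partners.  Writing the two nested uniform averages as sums, the claim is
--   Σ_{y ∈ W} Σ_{z ∈ W∖a} F(v∘(a y)∘(b z)) = Σ_{z ∈ W} Σ_{y ∈ W∖b} F(v∘(b z)∘(a y)),
-- together with |W∖a| = |W∖b|.  Both double sums split into seven pieces according to
-- whether the partners hit a, b or each other, and the pieces match term by term by the
-- commutation relations of transpositions.

open import Defs
open import Algebra.Bundles using (CommutativeMonoid)
open import Data.Bool using (Bool; true; false; not; _∧_; if_then_else_)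
open import Data.Empty using (⊥-elim)
open import Data.Fin using (Fin; zero; suc; _≟_)
open import Data.Fin.Permutation using (Permutation′; _⟨$⟩ʳ_; _⟨$⟩ˡ_; inverseˡ; inverseʳ)
open import Data.Fin.Permutation.Components using (transpose; transpose-inverse)
open import Data.Integer using (+_)
open import Data.List as List using (List; []; _∷_; _++_; [_]; filter; length; map; allFin; tabulate)
open import Data.List.Properties using (map-cong; length-map; ++-assoc; filter-≐)
open import Data.List.Membership.Propositional using (_∈_; _∉_)
open import Data.List.Membership.Propositional.Properties using (∈-tabulate⁺; ∈-tabulate⁻; ∈-++⁺ˡ; ∈-++⁺ʳ)
open import Data.List.Membership.Propositional.Properties.WithK using (unique∧set⇒bag)
open import Data.List.Relation.Binary.BagAndSetEquality using (∼bag⇒↭)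
open import Data.List.Relation.Binary.Permutation.Propositional using (_↭_; refl; prep; swap; trans; ↭-sym; ↭-reflexive; ↭⇒↭ₛ)
open import Data.List.Relation.Binary.Permutation.Propositional.Properties using (∈-resp-↭; ++⁺ˡ; ++⁺ʳ; shift)
import Data.List.Relation.Binary.Permutation.Setoid.Properties as PermutationSetoid
import Data.List.Relation.Unary.All as All
open import Data.List.Relation.Unary.AllPairs using (_∷_)
open import Data.List.Relation.Unary.Any using (here; any?)
open import Data.List.Relation.Unary.Unique.Propositional using (Unique)
open import Data.List.Relation.Unary.Unique.Propositional.Properties using (tabulate⁺)
open import Data.Nat as Nat using (ℕ; zero; suc)
import Data.Nat.Properties as ℕ
open import Data.Product using (_×_; _,_; proj₁; proj₂)
open import Data.Rational using (ℚ; 0ℚ; _+_; _*_; _/_)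
import Data.Rational.Properties as ℚ
open import Data.Vec using (lookup; _[_]≔_)
import Data.Vec as Vec
open import Data.Vec.Properties using (lookup∘update; lookup∘update′; tabulate∘lookup; tabulate-cong)
open import Function using (_∘_; case_of_)
open import Function.Bundles using (mk⇔)
open import Function.Definitions using (Injective)
open import Relation.Nullary using (yes; no; does; ¬?)
open import Relation.Nullary.Decidable using (dec-true; dec-false)
open import Relation.Unary using (Decidable)
open import Relation.Binary.PropositionalEquality as ≡ using (_≡_; _≢_; cong; cong₂; module ≡-Reasoning)

-- (1) Transpositions of Fin n and their action on value tables

transpose-matchˡ : ∀ {n} (i j : Fin n) → transpose i j i ≡ j
transpose-matchˡ i j rewrite dec-true (i ≟ i) ≡.refl = ≡.refl

transpose-matchʳ : ∀ {n} (i j : Fin n) → transpose i j j ≡ i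
transpose-matchʳ i j with j ≟ i
... | yes ≡.refl = ≡.refl
... | no j≢i rewrite dec-true (j ≟ j) ≡.refl = ≡.refl

transpose-other : ∀ {n} {i j k : Fin n} → k ≢ i → k ≢ j → transpose i j k ≡ k
transpose-other {i = i} {j} {k} k≢i k≢j rewrite dec-false (k ≟ i) k≢i | dec-false (k ≟ j) k≢j = ≡.refl

transpose-self : ∀ {n} (i k : Fin n) → transpose i i k ≡ k
transpose-self i k = case k ≟ i of λ where
  (yes ≡.refl) → transpose-matchˡ k k
  (no k≢i)     → transpose-other k≢i k≢i

transpose-comm : ∀ {n} (i j k : Fin n) → transpose i j k ≡ transpose j i k
transpose-comm i j k = case ((k ≟ i) , (k ≟ j)) of λ where
  (yes ≡.refl , yes ≡.refl) → ≡.refl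
  (yes ≡.refl , no k≢j)     → ≡.trans (transpose-matchˡ k j) (≡.sym (transpose-matchʳ j k))
  (no k≢i     , yes ≡.refl) → ≡.trans (transpose-matchʳ i k) (≡.sym (transpose-matchˡ k i))
  (no k≢i     , no k≢j)     → ≡.trans (transpose-other k≢i k≢j) (≡.sym (transpose-other k≢j k≢i))

transpose-injective : ∀ {n} (i j : Fin n) → Injective _≡_ _≡_ (transpose i j)
transpose-injective i j {k} {l} eq = begin
  k                                  ≡⟨ transpose-inverse j i ⟨
  transpose j i (transpose i j k)    ≡⟨ cong (transpose j i) eq ⟩
  transpose j i (transpose i j l)    ≡⟨ transpose-inverse j i ⟩
  l                                  ∎
  where open ≡-Reasoning

transpose-natural : ∀ {n} {σ : Fin n → Fin n} → Injective _≡_ _≡_ σ → ∀ i j k →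
  σ (transpose i j k) ≡ transpose (σ i) (σ j) (σ k)
transpose-natural {σ = σ} σ-inj i j k = case ((k ≟ i) , (k ≟ j)) of λ where
  (yes ≡.refl , _)          → ≡.trans (cong σ (transpose-matchˡ k j)) (≡.sym (transpose-matchˡ (σ k) (σ j)))
  (no k≢i     , yes ≡.refl) → ≡.trans (cong σ (transpose-matchʳ i k)) (≡.sym (transpose-matchʳ (σ i) (σ k)))
  (no k≢i     , no k≢j)     → ≡.trans (cong σ (transpose-other k≢i k≢j))
                                (≡.sym (transpose-other (k≢i ∘ σ-inj) (k≢j ∘ σ-inj)))

table-ext : ∀ {n} {u w : Table n} → (∀ p → lookup u p ≡ lookup w p) → u ≡ w
table-ext {u = u} {w} u≗w = begin
  u                          ≡⟨ tabulate∘lookup u ⟨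
  Vec.tabulate (lookup u)    ≡⟨ tabulate-cong u≗w ⟩
  Vec.tabulate (lookup w)    ≡⟨ tabulate∘lookup w ⟩
  w                          ∎
  where open ≡-Reasoning

lookup-swapAt : ∀ {n} (v : Table n) x y p → lookup (swapAt v x y) p ≡ lookup v (transpose x y p)
lookup-swapAt v x y p = case ((p ≟ y) , (p ≟ x)) of λ where
  (yes ≡.refl , _) →
    ≡.trans (lookup∘update p (v [ x ]≔ lookup v p) (lookup v x))
            (cong (lookup v) (≡.sym (transpose-matchʳ x p)))
  (no p≢y , yes ≡.refl) →
    ≡.trans (lookup∘update′ p≢y (v [ p ]≔ lookup v y) (lookup v p))
            (≡.trans (lookup∘update p v (lookup v y)) (cong (lookup v) (≡.sym (transpose-matchˡ p y))))
  (no p≢y , no p≢x) →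
    ≡.trans (lookup∘update′ p≢y (v [ x ]≔ lookup v y) (lookup v x))
            (≡.trans (lookup∘update′ p≢x v (lookup v y)) (cong (lookup v) (≡.sym (transpose-other p≢x p≢y))))

swapAt-self : ∀ {n} (v : Table n) x → swapAt v x x ≡ v
swapAt-self v x = table-ext λ p → ≡.trans (lookup-swapAt v x x p) (cong (lookup v) (transpose-self x p))

swapAt-comm : ∀ {n} (v : Table n) x y → swapAt v x y ≡ swapAt v y x
swapAt-comm v x y = table-ext λ p →
  ≡.trans (lookup-swapAt v x y p) (≡.trans (cong (lookup v) (transpose-comm x y p)) (≡.sym (lookup-swapAt v y x p)))

swapAt-exchange : ∀ {n} (v : Table n) a y b z →
  swapAt (swapAt v a y) b z ≡ swapAt (swapAt v (transpose a y b) (transpose a y z)) a y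
swapAt-exchange v a y b z = table-ext λ p → begin
  lookup (swapAt (swapAt v a y) b z) p          ≡⟨ lookup-swapAt (swapAt v a y) b z p ⟩
  lookup (swapAt v a y) (transpose b z p)       ≡⟨ lookup-swapAt v a y (transpose b z p) ⟩
  lookup v (transpose a y (transpose b z p))    ≡⟨ cong (lookup v) (transpose-natural (transpose-injective a y) b z p) ⟩
  lookup v (transpose b′ z′ (transpose a y p))  ≡⟨ lookup-swapAt v b′ z′ (transpose a y p) ⟨
  lookup (swapAt v b′ z′) (transpose a y p)     ≡⟨ lookup-swapAt (swapAt v b′ z′) a y p ⟨
  lookup (swapAt (swapAt v b′ z′) a y) p        ∎
  where
  open ≡-Reasoning
  b′ = transpose a y b
  z′ = transpose a y z

swapAt-disjoint : ∀ {n} (v : Table n) {a y b z : Fin n} → b ≢ a → b ≢ y → z ≢ a → z ≢ y →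
  swapAt (swapAt v a y) b z ≡ swapAt (swapAt v b z) a y
swapAt-disjoint v {a} {y} {b} {z} b≢a b≢y z≢a z≢y = begin
  swapAt (swapAt v a y) b z                                    ≡⟨ swapAt-exchange v a y b z ⟩
  swapAt (swapAt v (transpose a y b) (transpose a y z)) a y
    ≡⟨ cong₂ (λ p q → swapAt (swapAt v p q) a y) (transpose-other b≢a b≢y) (transpose-other z≢a z≢y) ⟩
  swapAt (swapAt v b z) a y                                    ∎
  where open ≡-Reasoning

swapAt-shared : ∀ {n} (v : Table n) {a y b : Fin n} → b ≢ a → b ≢ y →
  swapAt (swapAt v a y) b y ≡ swapAt (swapAt v b a) a y
swapAt-shared v {a} {y} {b} b≢a b≢y = begin
  swapAt (swapAt v a y) b y                                    ≡⟨ swapAt-exchange v a y b y ⟩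
  swapAt (swapAt v (transpose a y b) (transpose a y y)) a y
    ≡⟨ cong₂ (λ p q → swapAt (swapAt v p q) a y) (transpose-other b≢a b≢y) (transpose-matchʳ a y) ⟩
  swapAt (swapAt v b a) a y                                    ∎
  where open ≡-Reasoning

-- (2) Sums over subsets of Fin n

Subset : ℕ → Set
Subset n = Fin n → Bool

_∖_ : ∀ {n} → Subset n → Fin n → Subset n
(w ∖ c) i = not (does (i ≟ c)) ∧ w i

∖-member : ∀ {n} (w : Subset n) {i c : Fin n} → w i ≡ true → i ≢ c → (w ∖ c) i ≡ true
∖-member w {i} {c} wi i≢c rewrite dec-false (i ≟ c) i≢c = wi

∖-nonmember : ∀ {n} (w : Subset n) {i c : Fin n} → (w ∖ c) i ≡ true → i ≢ c
∖-nonmember w {i} {c} h with i ≟ c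
∖-nonmember w () | yes _
... | no i≢c = i≢c

∖-subset : ∀ {n} (w : Subset n) {i c : Fin n} → (w ∖ c) i ≡ true → w i ≡ true
∖-subset w {i} {c} h with i ≟ c
∖-subset w () | yes _
... | no _ = h

∖-comm : ∀ {n} (w : Subset n) (a b : Fin n) i → ((w ∖ a) ∖ b) i ≡ ((w ∖ b) ∖ a) i
∖-comm w a b i = ∧-swap (not (does (i ≟ b))) (not (does (i ≟ a))) (w i)
  where
  ∧-swap : ∀ p q r → p ∧ (q ∧ r) ≡ q ∧ (p ∧ r)
  ∧-swap true  q     r = ≡.refl
  ∧-swap false true  r = ≡.refl
  ∧-swap false false r = ≡.refl

module WeightedSum {c ℓ} (M : CommutativeMonoid c ℓ) where

  open CommutativeMonoid M using (Carrier; _≈_; setoid; reflexive)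
    renaming (_∙_ to _⊹_; ε to 0#; refl to ≈-refl; sym to ≈-sym; trans to ≈-trans; comm to ⊹-comm;
              ∙-cong to ⊹-cong; ∙-congˡ to ⊹-congˡ; ∙-congʳ to ⊹-congʳ;
              identityˡ to ⊹-identityˡ; identityʳ to ⊹-identityʳ)
  open import Algebra.Properties.CommutativeMonoid.Sum M using (sum; ∑-distrib-+; ∑-comm; sum-replicate-zero; sum-cong-≋)
  open import Algebra.Solver.CommutativeMonoid M using (solve; _⊕_; _⊜_)
  open import Relation.Binary.Reasoning.Setoid setoid

  when : Bool → Carrier → Carrier
  when b x = if b then x else 0#

  Σ⟨_⟩ : ∀ {n} → Subset n → (Fin n → Carrier) → Carrier
  Σ⟨ w ⟩ f = sum (λ i → when (w i) (f i))

  when-cong : ∀ b {x y} → (b ≡ true → x ≈ y) → when b x ≈ when b y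
  when-cong true  x≈y = x≈y ≡.refl
  when-cong false x≈y = ≈-refl

  when-sum : ∀ {n} b (f : Fin n → Carrier) → when b (sum f) ≈ sum (λ i → when b (f i))
  when-sum     true  f = ≈-refl
  when-sum {n} false f = ≈-sym (sum-replicate-zero n)

  listSum-filter : ∀ {n} {B : Set} {P : B → Set} (P? : Decidable P) (g : Fin n → B) (f : B → Carrier) →
    List.foldr _⊹_ 0# (map f (filter P? (tabulate g))) ≈ Σ⟨ does ∘ P? ∘ g ⟩ (f ∘ g)
  listSum-filter {zero}  P? g f = ≈-refl
  listSum-filter {suc n} P? g f with does (P? (g zero))
  ... | true  = ⊹-congˡ (listSum-filter P? (g ∘ suc) f)
  ... | false = ≈-trans (listSum-filter P? (g ∘ suc) f) (≈-sym (⊹-identityˡ _))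

  Σ-cong : ∀ {n} {w w′ : Subset n} {f g : Fin n → Carrier} →
    (∀ i → w i ≡ w′ i) → (∀ i → w i ≡ true → f i ≈ g i) → Σ⟨ w ⟩ f ≈ Σ⟨ w′ ⟩ g
  Σ-cong {w = w} {w′} {f} {g} w≗w′ f≈g = sum-cong-≋ λ i →
    ≈-trans (when-cong (w i) (f≈g i)) (reflexive (cong (λ b → when b (g i)) (w≗w′ i)))

  Σ-⊹ : ∀ {n} (w : Subset n) (f g : Fin n → Carrier) → Σ⟨ w ⟩ (λ i → f i ⊹ g i) ≈ Σ⟨ w ⟩ f ⊹ Σ⟨ w ⟩ g
  Σ-⊹ w f g = ≈-trans (sum-cong-≋ (λ i → when-⊹ (w i)))
                       (∑-distrib-+ (λ i → when (w i) (f i)) (λ i → when (w i) (g i)))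
    where
    when-⊹ : ∀ b {x y} → when b (x ⊹ y) ≈ when b x ⊹ when b y
    when-⊹ true  = ≈-refl
    when-⊹ false = ≈-sym (⊹-identityˡ 0#)

  Σ-singleton : ∀ {n} (c : Fin n) (f : Fin n → Carrier) → Σ⟨ (λ i → does (i ≟ c)) ⟩ f ≈ f c
  Σ-singleton {suc n} zero    f = ≈-trans (⊹-congˡ (sum-replicate-zero n)) (⊹-identityʳ (f zero))
  Σ-singleton {suc n} (suc c) f = ≈-trans (⊹-identityˡ _) (Σ-singleton c (f ∘ suc))

  Σ-extract : ∀ {n} (w : Subset n) (c : Fin n) (f : Fin n → Carrier) → w c ≡ true →
    Σ⟨ w ⟩ f ≈ f c ⊹ Σ⟨ w ∖ c ⟩ f
  Σ-extract w c f wc = begin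
    Σ⟨ w ⟩ f                                         ≈⟨ sum-cong-≋ split ⟩
    sum (λ i → at-c i ⊹ when ((w ∖ c) i) (f i))      ≈⟨ ∑-distrib-+ at-c (λ i → when ((w ∖ c) i) (f i)) ⟩
    Σ⟨ (λ i → does (i ≟ c)) ⟩ f ⊹ Σ⟨ w ∖ c ⟩ f       ≈⟨ ⊹-congʳ (Σ-singleton c f) ⟩
    f c ⊹ Σ⟨ w ∖ c ⟩ f                               ∎
    where
    at-c : Fin _ → Carrier
    at-c i = when (does (i ≟ c)) (f i)
    split : ∀ i → when (w i) (f i) ≈ at-c i ⊹ when ((w ∖ c) i) (f i)
    split i with i ≟ c
    ... | yes ≡.refl rewrite wc = ≈-sym (⊹-identityʳ _)
    ... | no _                  = ≈-sym (⊹-identityˡ _)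

  Σ-remove-swap : ∀ {n} (W : Subset n) {a b : Fin n} (f : Fin n → Carrier) →
    W a ≡ true → W b ≡ true → b ≢ a → f a ≈ f b → Σ⟨ W ∖ a ⟩ f ≈ Σ⟨ W ∖ b ⟩ f
  Σ-remove-swap W {a} {b} f Wa Wb b≢a fa≈fb = begin
    Σ⟨ W ∖ a ⟩ f                ≈⟨ Σ-extract (W ∖ a) b f (∖-member W Wb b≢a) ⟩
    f b ⊹ Σ⟨ (W ∖ a) ∖ b ⟩ f    ≈⟨ ⊹-cong (≈-sym fa≈fb) (Σ-cong (∖-comm W a b) (λ _ _ → ≈-refl)) ⟩
    f a ⊹ Σ⟨ (W ∖ b) ∖ a ⟩ f    ≈⟨ Σ-extract (W ∖ b) a f (∖-member W Wa (b≢a ∘ ≡.sym)) ⟨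
    Σ⟨ W ∖ b ⟩ f                ∎

  Σ-offDiagonal-comm : ∀ {n} (R : Subset n) (G : Fin n → Fin n → Carrier) →
    Σ⟨ R ⟩ (λ y → Σ⟨ R ∖ y ⟩ (G y)) ≈ Σ⟨ R ⟩ (λ z → Σ⟨ R ∖ z ⟩ (λ y → G y z))
  Σ-offDiagonal-comm {n} R G = begin
    Σ⟨ R ⟩ (λ y → Σ⟨ R ∖ y ⟩ (G y))                   ≈⟨ sum-cong-≋ (λ y → when-sum {n} (R y) _) ⟩
    sum (λ y → sum (λ z → pair y z))                  ≈⟨ ∑-comm pair ⟩
    sum (λ z → sum (λ y → pair y z))                  ≈⟨ sum-cong-≋ (λ z → sum-cong-≋ (λ y → reflexive (pair-sym y z))) ⟩
    sum (λ z → sum (λ y → when (R z) (when ((R ∖ z) y) (G y z))))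
                                                      ≈⟨ sum-cong-≋ (λ z → when-sum {n} (R z) _) ⟨
    Σ⟨ R ⟩ (λ z → Σ⟨ R ∖ z ⟩ (λ y → G y z))           ∎
    where
    pair : Fin n → Fin n → Carrier
    pair y z = when (R y) (when ((R ∖ y) z) (G y z))
    when-when : ∀ p q d {x} → when p (when (not d ∧ q) x) ≡ when q (when (not d ∧ p) x)
    when-when true  true  d     = ≡.refl
    when-when true  false true  = ≡.refl
    when-when true  false false = ≡.refl
    when-when false true  true  = ≡.refl
    when-when false true  false = ≡.refl
    when-when false false d     = ≡.refl
    does-≟-sym : (i j : Fin n) → does (i ≟ j) ≡ does (j ≟ i)
    does-≟-sym i j with i ≟ j | j ≟ i
    ... | yes _   | yes _   = ≡.refl
    ... | no _    | no _    = ≡.refl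
    ... | yes i≡j | no j≢i  = ⊥-elim (j≢i (≡.sym i≡j))
    ... | no i≢j  | yes j≡i = ⊥-elim (i≢j (≡.sym j≡i))
    pair-sym : ∀ y z → pair y z ≡ when (R z) (when ((R ∖ z) y) (G y z))
    pair-sym y z = ≡.trans (when-when (R y) (R z) (does (z ≟ y)))
                           (cong (λ d → when (R z) (when (not d ∧ R y) (G y z))) (does-≟-sym z y))

  -- Decomposition of the double sum over {(y , z) | y ∈ W, z ∈ W ∖ a} according to whether
  -- y ∈ {a , b} and whether z = b or z = y; here a ≠ b lie in W and R = W ∖ {a , b}.
  Σ²-split : ∀ {n} (W : Subset n) {a b : Fin n} (G : Fin n → Fin n → Carrier) →
    W a ≡ true → W b ≡ true → b ≢ a →
    let R = (W ∖ a) ∖ b in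
    Σ⟨ W ⟩ (λ y → Σ⟨ W ∖ a ⟩ (G y)) ≈
      (G a b ⊹ G b b) ⊹ ((Σ⟨ R ⟩ (λ y → G y b) ⊹ Σ⟨ R ⟩ (G a)) ⊹
        ((Σ⟨ R ⟩ (G b) ⊹ Σ⟨ R ⟩ (λ y → G y y)) ⊹ Σ⟨ R ⟩ (λ y → Σ⟨ R ∖ y ⟩ (G y))))
  Σ²-split W {a} {b} G Wa Wb b≢a = begin
    Σ⟨ W ⟩ inner                                  ≈⟨ Σ-extract W a inner Wa ⟩
    inner a ⊹ Σ⟨ W ∖ a ⟩ inner                    ≈⟨ ⊹-congˡ (Σ-extract (W ∖ a) b inner (∖-member W Wb b≢a)) ⟩
    inner a ⊹ (inner b ⊹ Σ⟨ R ⟩ inner)            ≈⟨ ⊹-cong (inner-at-b a) (⊹-cong (inner-at-b b) rest) ⟩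
    (G a b ⊹ Σ⟨ R ⟩ (G a)) ⊹ ((G b b ⊹ Σ⟨ R ⟩ (G b)) ⊹ (Σ⟨ R ⟩ (λ y → G y b) ⊹ (Σ⟨ R ⟩ (λ y → G y y) ⊹ off)))
      ≈⟨ solve 7 (λ x₁ x₂ x₃ x₄ x₅ x₆ x₇ → (x₁ ⊕ x₂) ⊕ ((x₃ ⊕ x₄) ⊕ (x₅ ⊕ (x₆ ⊕ x₇))) ⊜
                                           (x₁ ⊕ x₃) ⊕ ((x₅ ⊕ x₂) ⊕ ((x₄ ⊕ x₆) ⊕ x₇))) ≈-refl
           (G a b) (Σ⟨ R ⟩ (G a)) (G b b) (Σ⟨ R ⟩ (G b)) (Σ⟨ R ⟩ (λ y → G y b)) (Σ⟨ R ⟩ (λ y → G y y)) off ⟩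
    (G a b ⊹ G b b) ⊹ ((Σ⟨ R ⟩ (λ y → G y b) ⊹ Σ⟨ R ⟩ (G a)) ⊹ ((Σ⟨ R ⟩ (G b) ⊹ Σ⟨ R ⟩ (λ y → G y y)) ⊹ off)) ∎
    where
    R = (W ∖ a) ∖ b
    inner = λ y → Σ⟨ W ∖ a ⟩ (G y)
    off = Σ⟨ R ⟩ (λ y → Σ⟨ R ∖ y ⟩ (G y))
    inner-at-b : ∀ y → inner y ≈ G y b ⊹ Σ⟨ R ⟩ (G y)
    inner-at-b y = Σ-extract (W ∖ a) b (G y) (∖-member W Wb b≢a)
    rest : Σ⟨ R ⟩ inner ≈ Σ⟨ R ⟩ (λ y → G y b) ⊹ (Σ⟨ R ⟩ (λ y → G y y) ⊹ off)
    rest = begin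
      Σ⟨ R ⟩ inner                                       ≈⟨ Σ-cong (λ _ → ≡.refl) (λ y _ → inner-at-b y) ⟩
      Σ⟨ R ⟩ (λ y → G y b ⊹ Σ⟨ R ⟩ (G y))                ≈⟨ Σ-⊹ R _ _ ⟩
      Σ⟨ R ⟩ (λ y → G y b) ⊹ Σ⟨ R ⟩ (λ y → Σ⟨ R ⟩ (G y))
        ≈⟨ ⊹-congˡ (Σ-cong (λ _ → ≡.refl) (λ y Ry → Σ-extract R y (G y) Ry)) ⟩
      Σ⟨ R ⟩ (λ y → G y b) ⊹ Σ⟨ R ⟩ (λ y → G y y ⊹ Σ⟨ R ∖ y ⟩ (G y)) ≈⟨ ⊹-congˡ (Σ-⊹ R _ _) ⟩
      Σ⟨ R ⟩ (λ y → G y b) ⊹ (Σ⟨ R ⟩ (λ y → G y y) ⊹ off) ∎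

  Σ²-swapAt-exchange : ∀ {n} (W : Subset n) {a b : Fin n} (v : Table n) (F : Table n → Carrier) →
    W a ≡ true → W b ≡ true → a ≢ b →
    Σ⟨ W ⟩ (λ y → Σ⟨ W ∖ a ⟩ (λ z → F (swapAt (swapAt v a y) b z))) ≈
    Σ⟨ W ⟩ (λ z → Σ⟨ W ∖ b ⟩ (λ y → F (swapAt (swapAt v b z) a y)))
  Σ²-swapAt-exchange {n} W {a} {b} v F Wa Wb a≢b = begin
    Σ⟨ W ⟩ (λ y → Σ⟨ W ∖ a ⟩ (G y))
      ≈⟨ Σ²-split W G Wa Wb b≢a ⟩
    (G a b ⊹ G b b) ⊹ ((Σ⟨ R ⟩ (λ y → G y b) ⊹ Σ⟨ R ⟩ (G a)) ⊹
      ((Σ⟨ R ⟩ (G b) ⊹ Σ⟨ R ⟩ (λ y → G y y)) ⊹ Σ⟨ R ⟩ (λ y → Σ⟨ R ∖ y ⟩ (G y))))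
      ≈⟨ ⊹-cong (⊹-cong (same ab) (same bb))
           (⊹-cong (swapped (on-R yb) (on-R az)) (⊹-cong (swapped (on-R bz) (on-R yy)) off-diagonal)) ⟩
    (H b a ⊹ H a a) ⊹ ((Σ⟨ R′ ⟩ (λ z → H z a) ⊹ Σ⟨ R′ ⟩ (H b)) ⊹
      ((Σ⟨ R′ ⟩ (H a) ⊹ Σ⟨ R′ ⟩ (λ z → H z z)) ⊹ Σ⟨ R′ ⟩ (λ z → Σ⟨ R′ ∖ z ⟩ (H z))))
      ≈⟨ Σ²-split W H Wb Wa a≢b ⟨
    Σ⟨ W ⟩ (λ z → Σ⟨ W ∖ b ⟩ (H z)) ∎
    where
    G H : Fin n → Fin n → Carrier
    G y z = F (swapAt (swapAt v a y) b z)
    H z y = F (swapAt (swapAt v b z) a y)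
    R R′ : Subset n
    R  = (W ∖ a) ∖ b
    R′ = (W ∖ b) ∖ a
    b≢a = a≢b ∘ ≡.sym

    same : ∀ {s t} → s ≡ t → F s ≈ F t
    same eq = reflexive (cong F eq)

    swapped : ∀ {p q r s} → p ≈ r → q ≈ s → p ⊹ q ≈ s ⊹ r
    swapped p≈r q≈s = ≈-trans (⊹-cong p≈r q≈s) (⊹-comm _ _)

    outside : ∀ {i} → R i ≡ true → i ≢ a × i ≢ b
    outside Ri = ∖-nonmember W (∖-subset (W ∖ a) Ri) , ∖-nonmember (W ∖ a) Ri

    on-R : ∀ {f g : Fin n → Carrier} → (∀ i → i ≢ a → i ≢ b → f i ≈ g i) → Σ⟨ R ⟩ f ≈ Σ⟨ R′ ⟩ g
    on-R f≈g = Σ-cong (∖-comm W a b) (λ i Ri → f≈g i (proj₁ (outside Ri)) (proj₂ (outside Ri)))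

    -- in each of the seven pieces the two composite swaps produce the same table
    ab : swapAt (swapAt v a a) b b ≡ swapAt (swapAt v b b) a a
    ab = ≡.trans (swapAt-self _ b) (≡.trans (swapAt-self v a)
           (≡.sym (≡.trans (swapAt-self _ a) (swapAt-self v b))))

    bb : swapAt (swapAt v a b) b b ≡ swapAt (swapAt v b a) a a
    bb = ≡.trans (swapAt-self _ b) (≡.trans (swapAt-comm v a b) (≡.sym (swapAt-self _ a)))

    yb : ∀ y → y ≢ a → y ≢ b → G y b ≈ H b y
    yb y _ _ = same (≡.trans (swapAt-self _ b) (cong (λ u → swapAt u a y) (≡.sym (swapAt-self v b))))

    az : ∀ z → z ≢ a → z ≢ b → G a z ≈ H z a
    az z _ _ = same (≡.trans (cong (λ u → swapAt u b z) (swapAt-self v a)) (≡.sym (swapAt-self _ a)))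

    bz : ∀ z → z ≢ a → z ≢ b → G b z ≈ H z z
    bz z z≢a _ = same (≡.sym (swapAt-shared v a≢b (z≢a ∘ ≡.sym)))

    yy : ∀ y → y ≢ a → y ≢ b → G y y ≈ H a y
    yy y _ y≢b = same (swapAt-shared v b≢a (y≢b ∘ ≡.sym))

    yz : ∀ {y z} → y ≢ a → y ≢ b → z ≢ a → z ≢ y → G y z ≈ H z y
    yz y≢a y≢b z≢a z≢y = same (swapAt-disjoint v b≢a (y≢b ∘ ≡.sym) z≢a z≢y)

    off-diagonal : Σ⟨ R ⟩ (λ y → Σ⟨ R ∖ y ⟩ (G y)) ≈ Σ⟨ R′ ⟩ (λ z → Σ⟨ R′ ∖ z ⟩ (H z))
    off-diagonal = ≈-trans (Σ-offDiagonal-comm R G)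
      (Σ-cong (∖-comm W a b) λ z Rz →
         Σ-cong (λ y → cong (not (does (y ≟ z)) ∧_) (∖-comm W a b y)) λ y Ryz →
           let (y≢a , y≢b) = outside {y} (∖-subset R {y} {z} Ryz) in
           yz y≢a y≢b (proj₁ (outside Rz)) (∖-nonmember R {y} {z} Ryz ∘ ≡.sym))

-- (3) The swap process

-- Probabilities are summed in ℚ; numbers of admissible partners are counted in ℕ.
open WeightedSum ℚ.+-0-commutativeMonoid
module Count = WeightedSum ℕ.+-0-commutativeMonoid

unprocessed? : ∀ {n} (ex : List (Fin n)) → Decidable (_∉ ex)
unprocessed? ex y = ¬? (any? (y ≟_) ex)

fresh : ∀ {n} → List (Fin n) → Subset n
fresh ex y = does (unprocessed? ex y)

fresh-cons : ∀ {n} (e : Fin n) ex y → fresh (e ∷ ex) y ≡ (fresh ex ∖ e) y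
fresh-cons e ex y with y ≟ e
... | yes _ = ≡.refl
... | no _  = ≡.refl

fresh-snoc : ∀ {n} (ex : List (Fin n)) c y → fresh (ex ++ [ c ]) y ≡ (fresh ex ∖ c) y
fresh-snoc []       c y = fresh-cons c [] y
fresh-snoc (e ∷ ex) c y = begin
  fresh (e ∷ ex ++ [ c ]) y                       ≡⟨ fresh-cons e (ex ++ [ c ]) y ⟩
  not (does (y ≟ e)) ∧ fresh (ex ++ [ c ]) y      ≡⟨ cong (not (does (y ≟ e)) ∧_) (fresh-snoc ex c y) ⟩
  ((fresh ex ∖ c) ∖ e) y                          ≡⟨ ∖-comm (fresh ex) c e y ⟩
  not (does (y ≟ c)) ∧ (fresh ex ∖ e) y           ≡⟨ cong (not (does (y ≟ c)) ∧_) (fresh-cons e ex y) ⟨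
  (fresh (e ∷ ex) ∖ c) y                          ∎
  where open ≡-Reasoning

fresh-∉ : ∀ {n} {c : Fin n} {ex} → c ∉ ex → fresh ex c ≡ true
fresh-∉ {c = c} {ex} c∉ex = dec-true (unprocessed? ex c) c∉ex

allowed-↭ : ∀ {n} {ex ex′ : List (Fin n)} → ex ↭ ex′ → allowed ex ≡ allowed ex′
allowed-↭ {n} p = filter-≐ _ _ ((λ y∉ex y∈ex′ → y∉ex (∈-resp-↭ (↭-sym p) y∈ex′)) ,
                               (λ y∉ex′ y∈ex → y∉ex′ (∈-resp-↭ p y∈ex))) (allFin n)

average-cong : ∀ {A : Set} {f g : A → ℚ} (L : List A) → (∀ x → f x ≡ g x) → average (map f L) ≡ average (map g L)
average-cong L f≗g = cong average (map-cong f≗g L)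

swapProbFrom-↭ : ∀ {n} {ex ex′ : List (Fin n)} → ex ↭ ex′ → ∀ v xs t →
  swapProbFrom v ex xs t ≡ swapProbFrom v ex′ xs t
swapProbFrom-↭ p v []       t = ≡.refl
swapProbFrom-↭ {ex′ = ex′} p v (x ∷ xs) t =
  ≡.trans (cong (λ L → average (map (λ x′ → swapProbFrom (swapAt v x x′) (_ ++ [ x ]) xs t) L)) (allowed-↭ p))
          (average-cong (allowed ex′) (λ x′ → swapProbFrom-↭ (++⁺ʳ [ x ] p) (swapAt v x x′) xs t))

swapProbFrom-cons-cong : ∀ {n} (ex : List (Fin n)) c xs ys t →
  (∀ v′ → swapProbFrom v′ (ex ++ [ c ]) xs t ≡ swapProbFrom v′ (ex ++ [ c ]) ys t) →
  ∀ v → swapProbFrom v ex (c ∷ xs) t ≡ swapProbFrom v ex (c ∷ ys) t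
swapProbFrom-cons-cong ex c xs ys t xs≈ys v = average-cong (allowed ex) (λ x′ → xs≈ys (swapAt v c x′))

listSum : List ℚ → ℚ
listSum = List.foldr _+_ 0ℚ

-- the reciprocal of a count, with the convention 1/0 = 0 of the empty average
recip : ℕ → ℚ
recip zero    = 0ℚ
recip (suc k) = + 1 / suc k

average-map : ∀ {A : Set} (f : A → ℚ) (L : List A) → average (map f L) ≡ listSum (map f L) * recip (length L)
average-map f []      = ≡.refl
average-map f (y ∷ L) rewrite length-map f L = ≡.refl

listSum-*ʳ : ∀ {A : Set} (g : A → ℚ) (k : ℚ) (L : List A) →
  listSum (map (λ y → g y * k) L) ≡ listSum (map g L) * k
listSum-*ʳ g k []      = ≡.sym (ℚ.*-zeroˡ k)
listSum-*ʳ g k (y ∷ L) = ≡.trans (cong (λ s → g y * k + s) (listSum-*ʳ g k L)) (≡.sym (ℚ.*-distribʳ-+ k (g y) _))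

listSum-allowed : ∀ {n} (ex : List (Fin n)) (f : Fin n → ℚ) → listSum (map f (allowed ex)) ≡ Σ⟨ fresh ex ⟩ f
listSum-allowed ex f = listSum-filter (unprocessed? ex) (λ y → y) f

nested-average : ∀ {n} (ex : List (Fin n)) (a : Fin n) (K : Fin n → Fin n → ℚ) →
  average (map (λ y → average (map (K y) (allowed (ex ++ [ a ])))) (allowed ex)) ≡
  (Σ⟨ fresh ex ⟩ (λ y → Σ⟨ fresh ex ∖ a ⟩ (K y)) * recip (length (allowed (ex ++ [ a ])))) * recip (length (allowed ex))
nested-average {n} ex a K = begin
  average (map (λ y → average (map (K y) A′)) A)              ≡⟨ average-map _ A ⟩
  listSum (map (λ y → average (map (K y) A′)) A) * recip (length A)
    ≡⟨ cong (λ s → listSum s * recip (length A)) (map-cong (λ y → average-map (K y) A′) A) ⟩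
  listSum (map (λ y → listSum (map (K y) A′) * recip (length A′)) A) * recip (length A)
    ≡⟨ cong (_* recip (length A)) (listSum-*ʳ _ _ A) ⟩
  (listSum (map (λ y → listSum (map (K y) A′)) A) * recip (length A′)) * recip (length A)
    ≡⟨ cong (λ s → (s * recip (length A′)) * recip (length A)) double-sum ⟩
  (Σ⟨ fresh ex ⟩ (λ y → Σ⟨ fresh ex ∖ a ⟩ (K y)) * recip (length A′)) * recip (length A) ∎
  where
  open ≡-Reasoning
  A  = allowed ex
  A′ = allowed (ex ++ [ a ])
  double-sum : listSum (map (λ y → listSum (map (K y) A′)) A) ≡ Σ⟨ fresh ex ⟩ (λ y → Σ⟨ fresh ex ∖ a ⟩ (K y))
  double-sum = ≡.trans (listSum-allowed ex _)
    (Σ-cong (λ _ → ≡.refl) (λ y _ → ≡.trans (listSum-allowed (ex ++ [ a ]) (K y)) (Σ-cong (fresh-snoc ex a) (λ _ _ → ≡.refl))))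

allowed-length-swap : ∀ {n} (ex : List (Fin n)) {a b : Fin n} → fresh ex a ≡ true → fresh ex b ≡ true → a ≢ b →
  length (allowed (ex ++ [ a ])) ≡ length (allowed (ex ++ [ b ]))
allowed-length-swap ex {a} {b} fa fb a≢b = begin
  length (allowed (ex ++ [ a ]))                  ≡⟨ length-allowed (ex ++ [ a ]) ⟩
  Count.Σ⟨ fresh (ex ++ [ a ]) ⟩ (λ _ → 1)        ≡⟨ Count.Σ-cong (fresh-snoc ex a) (λ _ _ → ≡.refl) ⟩
  Count.Σ⟨ fresh ex ∖ a ⟩ (λ _ → 1)               ≡⟨ Count.Σ-remove-swap (fresh ex) (λ _ → 1) fa fb (a≢b ∘ ≡.sym) ≡.refl ⟩
  Count.Σ⟨ fresh ex ∖ b ⟩ (λ _ → 1)               ≡⟨ Count.Σ-cong (fresh-snoc ex b) (λ _ _ → ≡.refl) ⟨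
  Count.Σ⟨ fresh (ex ++ [ b ]) ⟩ (λ _ → 1)        ≡⟨ length-allowed (ex ++ [ b ]) ⟨
  length (allowed (ex ++ [ b ]))                  ∎
  where
  open ≡-Reasoning
  length-as-sum : ∀ {A : Set} (L : List A) → length L ≡ List.foldr Nat._+_ 0 (map (λ _ → 1) L)
  length-as-sum []      = ≡.refl
  length-as-sum (_ ∷ L) = cong suc (length-as-sum L)
  length-allowed : ∀ ex′ → length (allowed ex′) ≡ Count.Σ⟨ fresh ex′ ⟩ (λ _ → 1)
  length-allowed ex′ = ≡.trans (length-as-sum (allowed ex′)) (Count.listSum-filter (unprocessed? ex′) (λ y → y) (λ _ → 1))

swapProbFrom-adjacent : ∀ {n} (ex : List (Fin n)) {a b : Fin n} → fresh ex a ≡ true → fresh ex b ≡ true → a ≢ b →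
  ∀ v xs t → swapProbFrom v ex (a ∷ b ∷ xs) t ≡ swapProbFrom v ex (b ∷ a ∷ xs) t
swapProbFrom-adjacent ex {a} {b} fa fb a≢b v xs t = begin
  swapProbFrom v ex (a ∷ b ∷ xs) t
    ≡⟨ nested-average ex a (λ y z → F (swapAt (swapAt v a y) b z)) ⟩
  (Σ⟨ fresh ex ⟩ (λ y → Σ⟨ fresh ex ∖ a ⟩ (λ z → F (swapAt (swapAt v a y) b z)))
      * recip (length (allowed (ex ++ [ a ])))) * recip (length (allowed ex))
    ≡⟨ cong₂ (λ s k → (s * recip k) * recip (length (allowed ex)))
             (Σ²-swapAt-exchange (fresh ex) v F fa fb a≢b) (allowed-length-swap ex fa fb a≢b) ⟩
  (Σ⟨ fresh ex ⟩ (λ z → Σ⟨ fresh ex ∖ b ⟩ (λ y → F (swapAt (swapAt v b z) a y)))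
      * recip (length (allowed (ex ++ [ b ])))) * recip (length (allowed ex))
    ≡⟨ nested-average ex b (λ z y → F (swapAt (swapAt v b z) a y)) ⟨
  average (map (λ z → average (map (λ y → F (swapAt (swapAt v b z) a y)) (allowed (ex ++ [ b ])))) (allowed ex))
    ≡⟨ average-cong (allowed ex) (λ z → average-cong (allowed (ex ++ [ b ])) (λ y → swapProbFrom-↭ processed-swap _ xs t)) ⟩
  swapProbFrom v ex (b ∷ a ∷ xs) t ∎
  where
  open ≡-Reasoning
  F : Table _ → ℚ
  F w = swapProbFrom w ((ex ++ [ a ]) ++ [ b ]) xs t
  processed-swap : (ex ++ [ a ]) ++ [ b ] ↭ (ex ++ [ b ]) ++ [ a ]
  processed-swap = trans (↭-reflexive (++-assoc ex [ a ] [ b ]))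
                  (trans (++⁺ˡ ex (swap a b refl)) (↭-reflexive (≡.sym (++-assoc ex [ b ] [ a ]))))

-- (4) Reordering the positions

unique-resp-↭ : ∀ {n} {xs ys : List (Fin n)} → xs ↭ ys → Unique xs → Unique ys
unique-resp-↭ p = PermutationSetoid.Unique-resp-↭ (≡.setoid _) (↭⇒↭ₛ p)

unique-shift : ∀ {n} (ex : List (Fin n)) {c xs} → Unique (ex ++ c ∷ xs) → Unique ((ex ++ [ c ]) ++ xs)
unique-shift ex {c} {xs} = ≡.subst Unique (≡.sym (++-assoc ex [ c ] xs))

unique-∉ : ∀ {n} (ex : List (Fin n)) {c xs} → Unique (ex ++ c ∷ xs) → c ∉ ex
unique-∉ ex {c} {xs} u c∈ex with unique-resp-↭ (shift c ex xs) u
... | c∉rest ∷ _ = All.lookup c∉rest (∈-++⁺ˡ c∈ex) ≡.refl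

swapProbFrom-reorder : ∀ {n} {xs ys : List (Fin n)} → xs ↭ ys → ∀ ex → Unique (ex ++ xs) →
  ∀ v t → swapProbFrom v ex xs t ≡ swapProbFrom v ex ys t
swapProbFrom-reorder refl ex u v t = ≡.refl
swapProbFrom-reorder {xs = _ ∷ xs} {_ ∷ ys} (prep c p) ex u v t =
  swapProbFrom-cons-cong ex c xs ys t (λ v′ → swapProbFrom-reorder p (ex ++ [ c ]) (unique-shift ex u) v′ t) v
swapProbFrom-reorder {xs = a ∷ b ∷ xs} {_ ∷ _ ∷ ys} (swap a b p) ex u v t =
  ≡.trans (swapProbFrom-adjacent ex (fresh-∉ a∉ex) (fresh-∉ b∉ex) a≢b v xs t)
    (swapProbFrom-cons-cong ex b (a ∷ xs) (a ∷ ys) t (λ v′ → swapProbFrom-cons-cong (ex ++ [ b ]) a xs ys t (λ v″ →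
       swapProbFrom-reorder p ((ex ++ [ b ]) ++ [ a ]) (unique-shift (ex ++ [ b ]) (unique-shift ex u′)) v″ t) v′) v)
  where
  u′ : Unique (ex ++ b ∷ a ∷ xs)
  u′ = unique-resp-↭ (++⁺ˡ ex (swap a b refl)) u
  b∉ex+a : b ∉ ex ++ [ a ]
  b∉ex+a = unique-∉ (ex ++ [ a ]) (unique-shift ex u)
  a∉ex : a ∉ ex
  a∉ex = unique-∉ ex u
  b∉ex : b ∉ ex
  b∉ex = b∉ex+a ∘ ∈-++⁺ˡ
  a≢b : a ≢ b
  a≢b a≡b = b∉ex+a (∈-++⁺ʳ ex (here (≡.sym a≡b)))
swapProbFrom-reorder (trans p q) ex u v t =
  ≡.trans (swapProbFrom-reorder p ex u v t) (swapProbFrom-reorder q ex (unique-resp-↭ (++⁺ˡ ex p) u) v t)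

tabulate-reindex : ∀ {A : Set} {r} (x : Fin r → A) → Injective _≡_ _≡_ x → (ρ : Permutation′ r) →
  tabulate x ↭ tabulate (x ∘ (ρ ⟨$⟩ʳ_))
tabulate-reindex x x-inj ρ = ∼bag⇒↭ (unique∧set⇒bag (tabulate⁺ x-inj) (tabulate⁺ xρ-inj) (mk⇔ to from))
  where
  xρ-inj : Injective _≡_ _≡_ (x ∘ (ρ ⟨$⟩ʳ_))
  xρ-inj eq = ≡.trans (≡.sym (inverseˡ ρ)) (≡.trans (cong (ρ ⟨$⟩ˡ_) (x-inj eq)) (inverseˡ ρ))
  to : ∀ {z} → z ∈ tabulate x → z ∈ tabulate (x ∘ (ρ ⟨$⟩ʳ_))
  to z∈ with i , ≡.refl ← ∈-tabulate⁻ z∈ =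
    ≡.subst (_∈ tabulate (x ∘ (ρ ⟨$⟩ʳ_))) (cong x (inverseʳ ρ)) (∈-tabulate⁺ (ρ ⟨$⟩ˡ i))
  from : ∀ {z} → z ∈ tabulate (x ∘ (ρ ⟨$⟩ʳ_)) → z ∈ tabulate x
  from z∈ with i , ≡.refl ← ∈-tabulate⁻ z∈ = ∈-tabulate⁺ (ρ ⟨$⟩ʳ i)

-- The theorem: x ∘ ρ is a reordering of the duplicate-free list x.
propositionA2 : (n r : ℕ) (π : Permutation′ n) (x : Fin r → Fin n) →
    Injective _≡_ _≡_ x → (ρ : Permutation′ r) → (σ : Permutation′ n) →
    swapProb π (tabulate x) σ ≡ swapProb π (tabulate (x ∘ (ρ ⟨$⟩ʳ_))) σ
propositionA2 n r π x x-inj ρ σ =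
  swapProbFrom-reorder (tabulate-reindex x x-inj ρ) [] (tabulate⁺ x-inj) (table π) (table σ)
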